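{- For each integer $n \geq 3$, there exist graphs $G_1$ and $G_2$ such that $\chi(G_1)=1$, $\chi^{\mathrm{FAT}}(G_1)=n$, $\chi(G_2)=n$, and $\chi^{\mathrm{FAT}}(G_2)=1$.
   Context: All graphs are simple with a finite nonempty vertex set. $\chi(G)$ denotes the chromatic number of $G$. For a vertex $v$ and a set $S\subseteq V(G)$, let $e(v,S)=|S\cap N(v)|$, where $N(v)$ is the set of neighbors of $v$ and $\deg(v)=|N(v)|$. A (not necessarily proper) vertex coloring of $G$ with color classes $V_1,\dots,V_k$ is a Fair And Tolerant (FAT) $k$-coloring if $V_1,\dots,V_k$ are all nonempty, they partition $V(G)$, and there exist real numbers $\alpha,\beta\in[0,1]$ such that for every vertex $v$ and every $i\in\{1,\dots,k\}$: $e(v,V_i)=\alpha\deg(v)$ if $v\notin V_i$, and $e(v,V_i)=\beta\deg(v)$ if $v\in V_i$. The FAT chromatic number $\chi^{\mathrm{FAT}}(G)$ is the maximum $k$ such that $G$ admits a FAT $k$-coloring (a FAT $1$-coloring always exists).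
   Formalization: The numbers α and β in the definition of a FAT coloring range over the rationals in [0,1] instead of the real numbers. -}

module Defs where

open import Data.Nat using (ℕ; zero; suc; _+_; _≤_; NonZero)
open import Data.Bool using (Bool; true; false; _∧_)
open import Data.Fin using (Fin; _≟_)
open import Data.List using (List; []; _∷_)
open import Data.Fin.Base using ()
open import Data.List.Base using ()
open import Data.Product using (Σ; _×_; ∃)
open import Relation.Binary.PropositionalEquality using (_≡_; _≢_)
open import Relation.Nullary.Decidable using (⌊_⌋)
open import Data.Integer using (+_)
import Data.Rational as ℚ
open ℚ using (ℚ; 0ℚ; 1ℚ)

allFin : (n : ℕ) → List (Fin n)
allFin n = Data.List.allFin n
  where import Data.List

countB : {A : Set} → (A → Bool) → List A → ℕ
countB p [] = 0
countB p (x ∷ xs) with p x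
... | true  = suc (countB p xs)
... | false = countB p xs

record Graph : Set where
  field
    vsize    : ℕ
    nonempty : 1 ≤ vsize
    adj      : Fin vsize → Fin vsize → Bool
    adj-sym  : ∀ u v → adj u v ≡ adj v u
    adj-irr  : ∀ v → adj v v ≡ false
open Graph public

deg : (G : Graph) → Fin (vsize G) → ℕ
deg G v = countB (λ u → adj G v u) (allFin (vsize G))

eClass : (G : Graph) {k : ℕ} → (Fin (vsize G) → Fin k) → Fin (vsize G) → Fin k → ℕ
eClass G c v i = countB (λ u → adj G v u ∧ ⌊ c u ≟ i ⌋) (allFin (vsize G))

ℕtoℚ : ℕ → ℚ
ℕtoℚ m = (+ m) ℚ./ 1

ProperColoring : (G : Graph) (k : ℕ) → Set
ProperColoring G k =
  Σ (Fin (vsize G) → Fin k) λ c → ∀ u v → adj G u v ≡ true → c u ≢ c v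

IsChromaticNumber : Graph → ℕ → Set
IsChromaticNumber G k = ProperColoring G k × (∀ j → ProperColoring G j → k ≤ j)

FATColoring : (G : Graph) (k : ℕ) → Set
FATColoring G k =
  Σ (Fin (vsize G) → Fin k) λ c →
    (∀ i → ∃ λ v → c v ≡ i) ×
    Σ ℚ λ α → Σ ℚ λ β →
      (0ℚ ℚ.≤ α) × (α ℚ.≤ 1ℚ) × (0ℚ ℚ.≤ β) × (β ℚ.≤ 1ℚ) ×
      (∀ v i → (c v ≢ i → ℕtoℚ (eClass G c v i) ≡ α ℚ.* ℕtoℚ (deg G v))
             × (c v ≡ i → ℕtoℚ (eClass G c v i) ≡ β ℚ.* ℕtoℚ (deg G v)))

IsFATChromaticNumber : Graph → ℕ → Set
IsFATChromaticNumber G k = FATColoring G k × (∀ j → FATColoring G j → j ≤ k)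

-- G₁ is the edgeless graph on n vertices: colouring each vertex by itself is FAT with
-- α = β = 0, and nonempty classes force k ≤ n.  G₂ is the clique Kₙ with a pendant
-- vertex ℓ attached to a hub h.  Since deg ℓ = 1, a FAT k-colouring with k ≥ 2 has
-- α, β ∈ {0, 1}, read off at ℓ.  If ℓ and h share a colour then α = 0, so h has no
-- neighbour outside its class; but every other class is nonempty and h is adjacent to
-- all other vertices.  Otherwise β = 0 and α = 1: the colouring is proper, so k ≥ n ≥ 3,
-- and a third class missing N[ℓ] gives e(ℓ, V_i) = 0 ≠ α.
module Submission where

open import Defs
open import Data.Bool using (Bool; true; false; not; _∧_)
open import Data.Bool.Properties using (∧-identityʳ)
open import Data.Fin using (Fin; _≟_; fromℕ<) renaming (zero to fz; suc to fs)
open import Data.Fin.Properties using (injective⇒≤)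
open import Data.Integer using (+_)
open import Data.Integer.Properties using (+-injective)
open import Data.List using (List; []; _∷_; tabulate)
open import Data.List.Membership.Propositional using (_∈_)
open import Data.List.Membership.Propositional.Properties using (∈-allFin)
open import Data.List.Relation.Unary.Any using (here; there)
open import Data.Nat using (ℕ; zero; suc; _+_; _≤_; z≤n; s≤s)
open import Data.Nat.Properties using (≤-trans; <⇒≤)
import Data.Nat.Coprimality as Coprime
open import Data.Product using (Σ; ∃; _×_; _,_; proj₁; proj₂)
import Data.Rational as ℚ
open ℚ using (ℚ; 0ℚ; 1ℚ; ↥_)
import Data.Rational.Properties as ℚ
open import Function using (_∘_; id)
open import Relation.Nullary using (¬_; yes; no; contradiction)
open import Relation.Nullary.Decidable using (⌊_⌋; isYes≗does; dec-true; dec-false; decidable-stable)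
open import Relation.Binary.PropositionalEquality

countB-none : {A : Set} {p : A → Bool} (xs : List A) →
              (∀ x → p x ≡ false) → countB p xs ≡ 0
countB-none []       none = refl
countB-none {p = p} (x ∷ xs) none with p x | none x
... | false | refl = countB-none xs none

countB-tabulate-none : {A : Set} {p : A → Bool} {k : ℕ} (f : Fin k → A) →
                       (∀ i → p (f i) ≡ false) → countB p (tabulate f) ≡ 0
countB-tabulate-none {k = zero}  f none = refl
countB-tabulate-none {p = p} {k = suc k} f none with p (f fz) | none fz
... | false | refl = countB-tabulate-none (f ∘ fs) (none ∘ fs)

countB-∈ : {A : Set} {p : A → Bool} {x : A} {xs : List A} →
           x ∈ xs → p x ≡ true → countB p xs ≢ 0
countB-∈ {p = p} {xs = y ∷ ys} (here refl) px with p y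
countB-∈ (here refl) refl | true = λ ()
countB-∈ {p = p} {xs = y ∷ ys} (there x∈ys) px with p y
... | true  = λ ()
... | false = countB-∈ x∈ys px

countB-cong : {A : Set} {p q : A → Bool} (xs : List A) →
              (∀ x → p x ≡ q x) → countB p xs ≡ countB q xs
countB-cong []       p≗q = refl
countB-cong {p = p} {q} (x ∷ xs) p≗q with p x | q x | p≗q x
... | true  | true  | refl = cong suc (countB-cong xs p≗q)
... | false | false | refl = countB-cong xs p≗q

ℕtoℚ-injective : ∀ {m n} → ℕtoℚ m ≡ ℕtoℚ n → m ≡ n
ℕtoℚ-injective {m} {n} eq = +-injective (begin
  + m              ≡⟨ cong ↥_ (ℚ.normalize-coprime (Coprime.sym (Coprime.1-coprimeTo m))) ⟨
  ↥ ℕtoℚ m         ≡⟨ cong ↥_ eq ⟩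
  ↥ ℕtoℚ n         ≡⟨ cong ↥_ (ℚ.normalize-coprime (Coprime.sym (Coprime.1-coprimeTo n))) ⟩
  + n              ∎)
  where open ≡-Reasoning

ℕtoℚ≡0*⇒≡0 : ∀ {m} q → ℕtoℚ m ≡ 0ℚ ℚ.* q → m ≡ 0
ℕtoℚ≡0*⇒≡0 q eq = ℕtoℚ-injective (trans eq (ℚ.*-zeroˡ q))

⌊≟⌋-true : ∀ {n} {x y : Fin n} → x ≡ y → ⌊ x ≟ y ⌋ ≡ true
⌊≟⌋-true {x = x} {y} x≡y = trans (isYes≗does (x ≟ y)) (dec-true (x ≟ y) x≡y)

⌊≟⌋-false : ∀ {n} {x y : Fin n} → x ≢ y → ⌊ x ≟ y ⌋ ≡ false
⌊≟⌋-false {x = x} {y} x≢y = trans (isYes≗does (x ≟ y)) (dec-false (x ≟ y) x≢y)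

⌊≟⌋-sym : ∀ {n} (x y : Fin n) → ⌊ x ≟ y ⌋ ≡ ⌊ y ≟ x ⌋
⌊≟⌋-sym x y with x ≟ y
... | yes x≡y = sym (⌊≟⌋-true (sym x≡y))
... | no  x≢y = sym (⌊≟⌋-false (x≢y ∘ sym))

avoid-one : ∀ {k} → 2 ≤ k → (a : Fin k) → ∃ λ i → a ≢ i
avoid-one (s≤s (s≤s _)) fz     = fs fz , λ ()
avoid-one (s≤s (s≤s _)) (fs _) = fz , λ ()

avoid-two : ∀ {k} → 3 ≤ k → (a b : Fin k) → ∃ λ i → a ≢ i × b ≢ i
avoid-two (s≤s (s≤s (s≤s _))) fz          fz          = fs fz , (λ ()) , (λ ())
avoid-two (s≤s (s≤s (s≤s _))) fz          (fs fz)     = fs (fs fz) , (λ ()) , (λ ())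
avoid-two (s≤s (s≤s (s≤s _))) fz          (fs (fs _)) = fs fz , (λ ()) , (λ ())
avoid-two (s≤s (s≤s (s≤s _))) (fs fz)     fz          = fs (fs fz) , (λ ()) , (λ ())
avoid-two (s≤s (s≤s (s≤s _))) (fs (fs _)) fz          = fs fz , (λ ()) , (λ ())
avoid-two (s≤s (s≤s (s≤s _))) (fs _)      (fs _)      = fz , (λ ()) , (λ ())

adj⇒≢ : (G : Graph) {u v : Fin (vsize G)} → adj G u v ≡ true → u ≢ v
adj⇒≢ G {u} uv refl with trans (sym (adj-irr G u)) uv
... | ()

FATCondition : (G : Graph) {k : ℕ} → (Fin (vsize G) → Fin k) → ℚ → ℚ → Set
FATCondition G c α β =
  ∀ v i → (c v ≢ i → ℕtoℚ (eClass G c v i) ≡ α ℚ.* ℕtoℚ (deg G v))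
        × (c v ≡ i → ℕtoℚ (eClass G c v i) ≡ β ℚ.* ℕtoℚ (deg G v))

colours-positive : (G : Graph) {k : ℕ} → (Fin (vsize G) → Fin k) → 1 ≤ k
colours-positive G {zero} c with c (fromℕ< (nonempty G))
... | ()
colours-positive G {suc k} c = s≤s z≤n

FATColoring⇒≤vsize : (G : Graph) {k : ℕ} → FATColoring G k → k ≤ vsize G
FATColoring⇒≤vsize G (c , onto , _) = injective⇒≤ {f = proj₁ ∘ onto} section-injective
  where
  section-injective : ∀ {i j} → proj₁ (onto i) ≡ proj₁ (onto j) → i ≡ j
  section-injective {i} {j} eq =
    trans (sym (proj₂ (onto i))) (trans (cong c eq) (proj₂ (onto j)))

coefficient-at-leaf : (G : Graph) {v : Fin (vsize G)} (γ : ℚ) (e : ℕ) → deg G v ≡ 1 →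
                      ℕtoℚ e ≡ γ ℚ.* ℕtoℚ (deg G v) → γ ≡ ℕtoℚ e
coefficient-at-leaf G γ e deg≡1 eq rewrite deg≡1 = sym (trans eq (ℚ.*-identityʳ γ))

eClass-neighbour : (G : Graph) {k : ℕ} (c : Fin (vsize G) → Fin k) {u v : Fin (vsize G)} →
                   adj G u v ≡ true → eClass G c u (c v) ≢ 0
eClass-neighbour G c {u} {v} uv = countB-∈ (∈-allFin v) v-counted
  where
  v-counted : adj G u v ∧ ⌊ c v ≟ c v ⌋ ≡ true
  v-counted rewrite uv = ⌊≟⌋-true refl

module FATConditionProperties (G : Graph) {k : ℕ} (c : Fin (vsize G) → Fin k) (α β : ℚ)
         (fat : FATCondition G c α β) where

  β≡0⇒proper : β ≡ 0ℚ → ∀ u v → adj G u v ≡ true → c u ≢ c v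
  β≡0⇒proper refl u v uv cu≡cv = eClass-neighbour G c uv (ℕtoℚ≡0*⇒≡0 (ℕtoℚ (deg G u)) own-class)
    where
    own-class : ℕtoℚ (eClass G c u (c v)) ≡ 0ℚ ℚ.* ℕtoℚ (deg G u)
    own-class = proj₂ (fat u (c v)) cu≡cv

  α≡0⇒monochromatic : α ≡ 0ℚ → ∀ u v → adj G u v ≡ true → c u ≡ c v
  α≡0⇒monochromatic refl u v uv with c u ≟ c v
  ... | yes cu≡cv = cu≡cv
  ... | no  cu≢cv = contradiction (ℕtoℚ≡0*⇒≡0 (ℕtoℚ (deg G u)) (proj₁ (fat u (c v)) cu≢cv))
                                  (eClass-neighbour G c uv)

  α-at-leaf : ∀ v {i} → deg G v ≡ 1 → c v ≢ i → α ≡ ℕtoℚ (eClass G c v i)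
  α-at-leaf v {i} deg≡1 c-v≢i =
    coefficient-at-leaf G α (eClass G c v i) deg≡1 (proj₁ (fat v i) c-v≢i)

  β-at-leaf : ∀ v → deg G v ≡ 1 → β ≡ ℕtoℚ (eClass G c v (c v))
  β-at-leaf v deg≡1 =
    coefficient-at-leaf G β (eClass G c v (c v)) deg≡1 (proj₂ (fat v (c v)) refl)

edgeless : (n : ℕ) → 1 ≤ n → Graph
edgeless n n≥1 = record
  { vsize = n ; nonempty = n≥1 ; adj = λ _ _ → false
  ; adj-sym = λ _ _ → refl ; adj-irr = λ _ → refl }

edgeless-χ : ∀ n n≥1 → IsChromaticNumber (edgeless n n≥1) 1
edgeless-χ n n≥1 = ((λ _ → fz) , λ _ _ ()) , λ _ (c , _) → colours-positive (edgeless n n≥1) c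

edgeless-FAT : ∀ n n≥1 → IsFATChromaticNumber (edgeless n n≥1) n
edgeless-FAT n n≥1 =
  ( id , (λ i → i , refl) , 0ℚ , 0ℚ
  , ℚ.≤-refl , ℚ.nonNegative⁻¹ 1ℚ , ℚ.≤-refl , ℚ.nonNegative⁻¹ 1ℚ
  , λ v i → (λ _ → no-neighbours v i) , (λ _ → no-neighbours v i))
  , λ _ → FATColoring⇒≤vsize G
  where
  G = edgeless n n≥1
  no-neighbours : ∀ v i → ℕtoℚ (eClass G id v i) ≡ 0ℚ ℚ.* ℕtoℚ (deg G v)
  no-neighbours v i = trans (cong ℕtoℚ (countB-none (allFin n) λ _ → refl))
                            (sym (ℚ.*-zeroˡ (ℕtoℚ (deg G v))))

isHub : ∀ {n} → Fin n → Bool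
isHub fz     = true
isHub (fs _) = false

-- Vertex fz is the pendant vertex, joined to the hub fs fz of the clique {fs x}.
pendant-adj : ∀ {n} → Fin (suc n) → Fin (suc n) → Bool
pendant-adj fz     fz     = false
pendant-adj fz     (fs y) = isHub y
pendant-adj (fs x) fz     = isHub x
pendant-adj (fs x) (fs y) = not ⌊ x ≟ y ⌋

pendant-adj-sym : ∀ {n} (u v : Fin (suc n)) → pendant-adj u v ≡ pendant-adj v u
pendant-adj-sym fz     fz     = refl
pendant-adj-sym fz     (fs y) = refl
pendant-adj-sym (fs x) fz     = refl
pendant-adj-sym (fs x) (fs y) = cong not (⌊≟⌋-sym x y)

pendant-adj-irr : ∀ {n} (v : Fin (suc n)) → pendant-adj v v ≡ false
pendant-adj-irr fz     = refl
pendant-adj-irr (fs x) = cong not (⌊≟⌋-true refl)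

pendantClique : ℕ → Graph
pendantClique n = record
  { vsize = 2 + n ; nonempty = s≤s z≤n ; adj = pendant-adj
  ; adj-sym = pendant-adj-sym ; adj-irr = pendant-adj-irr }

module _ {n : ℕ} where

  private
    G = pendantClique n

  leaf hub : Fin (2 + n)
  leaf = fz
  hub  = fs fz

  clique-adjacent : {x y : Fin (suc n)} → x ≢ y → adj G (fs x) (fs y) ≡ true
  clique-adjacent x≢y = cong not (⌊≟⌋-false x≢y)

  hub-adjacent : ∀ v → v ≢ hub → adj G hub v ≡ true
  hub-adjacent fz          _     = refl
  hub-adjacent (fs fz)     v≢hub = contradiction refl v≢hub
  hub-adjacent (fs (fs y)) _     = clique-adjacent {fz} {fs y} λ ()

  deg-leaf : deg G leaf ≡ 1
  deg-leaf = cong suc (countB-tabulate-none {p = adj G leaf} (fs ∘ fs) λ _ → refl)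

  module _ {k : ℕ} (c : Fin (2 + n) → Fin k) where

    in-class-beside-leaf : Fin k → Fin (2 + n) → Bool
    in-class-beside-leaf i u = adj G leaf u ∧ ⌊ c u ≟ i ⌋

    eClass-leaf-hub : ∀ {i} → c hub ≡ i → eClass G c leaf i ≡ 1
    eClass-leaf-hub {i} c-hub≡i rewrite ⌊≟⌋-true c-hub≡i =
      cong suc (countB-tabulate-none {p = in-class-beside-leaf i} (fs ∘ fs) λ _ → refl)

    eClass-leaf-other : ∀ {i} → c hub ≢ i → eClass G c leaf i ≡ 0
    eClass-leaf-other {i} c-hub≢i rewrite ⌊≟⌋-false c-hub≢i =
      countB-tabulate-none {p = in-class-beside-leaf i} (fs ∘ fs) λ _ → refl

pendantClique-χ : ∀ {n} → 1 ≤ n → IsChromaticNumber (pendantClique n) (suc n)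
pendantClique-χ {suc n} _ = (colour , proper) , λ _ (c , c-proper) →
  injective⇒≤ {f = c ∘ fs} λ {x} {y} c-x≡c-y →
    decidable-stable (x ≟ y) λ x≢y → c-proper (fs x) (fs y) (clique-adjacent x≢y) c-x≡c-y
  where
  G = pendantClique (suc n)
  colour : Fin (vsize G) → Fin (2 + n)
  colour fz     = fs fz
  colour (fs x) = x
  proper : ∀ u v → adj G u v ≡ true → colour u ≢ colour v
  proper fz          fz          ()
  proper fz          (fs fz)     _  ()
  proper fz          (fs (fs _)) ()
  proper (fs fz)     fz          _  ()
  proper (fs (fs _)) fz          ()
  proper (fs x)      (fs y)      xy = adj⇒≢ G xy ∘ cong fs

module PendantCliqueFAT {n k : ℕ} (c : Fin (2 + n) → Fin k) (α β : ℚ)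
         (fat : FATCondition (pendantClique n) c α β) where

  private
    G = pendantClique n
  open FATConditionProperties G c α β fat

  leaf-α≡0 : ∀ {i} → c leaf ≢ i → c hub ≢ i → α ≡ 0ℚ
  leaf-α≡0 {i} c-leaf≢i c-hub≢i =
    trans (α-at-leaf leaf (deg-leaf {n}) c-leaf≢i)
          (cong ℕtoℚ (eClass-leaf-other c c-hub≢i))

  leaf-α≡1 : c leaf ≢ c hub → α ≡ 1ℚ
  leaf-α≡1 c-leaf≢c-hub =
    trans (α-at-leaf leaf (deg-leaf {n}) c-leaf≢c-hub)
          (cong ℕtoℚ (eClass-leaf-hub c refl))

  leaf-β≡0 : c leaf ≢ c hub → β ≡ 0ℚ
  leaf-β≡0 c-leaf≢c-hub =
    trans (β-at-leaf leaf (deg-leaf {n}))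
          (cong ℕtoℚ (eClass-leaf-other c (c-leaf≢c-hub ∘ sym)))

  leaf-colour≢hub-colour : 2 ≤ k → (∀ i → ∃ λ v → c v ≡ i) → c leaf ≢ c hub
  leaf-colour≢hub-colour k≥2 onto c-leaf≡c-hub = c-hub≢i (trans c-hub≡c-v c-v≡i)
    where
    i        = proj₁ (avoid-one k≥2 (c leaf))
    c-leaf≢i = proj₂ (avoid-one k≥2 (c leaf))
    c-hub≢i : c hub ≢ i
    c-hub≢i = c-leaf≢i ∘ trans c-leaf≡c-hub
    v     = proj₁ (onto i)
    c-v≡i = proj₂ (onto i)
    c-hub≡c-v : c hub ≡ c v
    c-hub≡c-v = α≡0⇒monochromatic (leaf-α≡0 c-leaf≢i c-hub≢i)
                  hub v (hub-adjacent v λ v≡hub → c-hub≢i (trans (cong c (sym v≡hub)) c-v≡i))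

  leaf-colour≡hub-colour : 2 ≤ n → ¬ c leaf ≢ c hub
  leaf-colour≡hub-colour n≥2 c-leaf≢c-hub =
    ℚ.1≢0 (trans (sym (leaf-α≡1 c-leaf≢c-hub)) (leaf-α≡0 c-leaf≢i c-hub≢i))
    where
    proper : ProperColoring G k
    proper = c , β≡0⇒proper (leaf-β≡0 c-leaf≢c-hub)
    k≥3 : 3 ≤ k
    k≥3 = ≤-trans (s≤s n≥2) (proj₂ (pendantClique-χ (<⇒≤ n≥2)) k proper)
    i        = proj₁ (avoid-two k≥3 (c leaf) (c hub))
    c-leaf≢i = proj₁ (proj₂ (avoid-two k≥3 (c leaf) (c hub)))
    c-hub≢i  = proj₂ (proj₂ (avoid-two k≥3 (c leaf) (c hub)))

pendantClique-FAT : ∀ {n} → 2 ≤ n → IsFATChromaticNumber (pendantClique n) 1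
pendantClique-FAT {n} n≥2 =
  ( monochrome , (λ { fz → leaf , refl }) , 0ℚ , 1ℚ
  , ℚ.≤-refl , ℚ.nonNegative⁻¹ 1ℚ , ℚ.nonNegative⁻¹ 1ℚ , ℚ.≤-refl
  , λ v → λ { fz → (λ fz≢fz → contradiction refl fz≢fz) , (λ _ → all-neighbours v) })
  , at-most-one
  where
  G = pendantClique n
  monochrome : Fin (vsize G) → Fin 1
  monochrome _ = fz
  all-neighbours : ∀ v → ℕtoℚ (eClass G monochrome v fz) ≡ 1ℚ ℚ.* ℕtoℚ (deg G v)
  all-neighbours v = trans (cong ℕtoℚ (countB-cong (allFin (2 + n)) λ u → ∧-identityʳ (adj G v u)))
                           (sym (ℚ.*-identityˡ (ℕtoℚ (deg G v))))
  at-most-one : ∀ j → FATColoring G j → j ≤ 1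
  at-most-one zero          _ = z≤n
  at-most-one (suc zero)    _ = s≤s z≤n
  at-most-one (suc (suc j)) (c , onto , α , β , _ , _ , _ , _ , fat) =
    contradiction (leaf-colour≢hub-colour (s≤s (s≤s z≤n)) onto) (leaf-colour≡hub-colour n≥2)
    where open PendantCliqueFAT c α β fat

theorem3p1 : (n : ℕ) → 3 ≤ n →
    Σ Graph λ G₁ → Σ Graph λ G₂ →
      IsChromaticNumber G₁ 1 × IsFATChromaticNumber G₁ n ×
      IsChromaticNumber G₂ n × IsFATChromaticNumber G₂ 1
theorem3p1 (suc n) (s≤s n≥2) =
  edgeless (suc n) (s≤s z≤n) , pendantClique n ,
  edgeless-χ (suc n) (s≤s z≤n) , edgeless-FAT (suc n) (s≤s z≤n) ,
  pendantClique-χ (<⇒≤ n≥2) , pendantClique-FAT n≥2
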